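{- For every integer $C\geq1$ there exists $r_0$ such that for every integer $r\geq r_0$ the following holds. Let $T'$ be the perfect ternary tree with $C+1$ levels (so it has $(3^C-1)/2$ internal vertices and $3^C$ leaves), and let $T$ be a tree obtained by gluing to each leaf of $T'$ a (possibly different) tree on $r$ vertices. Let $G$ be a graph with vertex partition $V(G)=U_1\cup U_2\cup W$ such that $|U_1|=|U_2|$, $|W|=C$, $G[U_1]$, $G[U_2]$ and the bipartite graph $G[U_1\cup U_2,W]$ are complete, and $G$ has no other edges. If $G$ contains a copy of $T$, then $|U_1|\geq(3^C+1)r/2$.
   Context: The perfect ternary tree with $C+1$ levels is the rooted tree with levels $0,1,\dots,C$ in which the root is at level $0$, every vertex at level $i<C$ has exactly three children (at level $i+1$), and the vertices at level $C$ are the leaves. Gluing a tree $S$ to a leaf $\ell$ means identifying $\ell$ with a vertex of $S$ (so the $r$-vertex tree contributes $r-1$ new vertices). $G[U_1\cup U_2,W]$ denotes the bipartite graph of edges between $U_1\cup U_2$ and $W$. -}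

module Defs where

open import Data.Nat using (ℕ; zero; suc; _+_)
open import Data.Fin using (Fin; zero; suc)
open import Data.Vec using (Vec; []; _∷_)
open import Data.List using (List; []; _∷_; map; sum)
open import Data.List.Membership.Propositional using (_∈_)
open import Data.Product using (Σ; _×_)
open import Relation.Binary.PropositionalEquality using (_≡_)
open import Relation.Nullary using (¬_)

-- Finite rooted trees (unordered in meaning; children given as a list).
-- Every finite tree with a distinguished vertex is represented by some RTree.
data RTree : Set where
  node : List RTree → RTree

children : RTree → List RTree
children (node ts) = ts

size : RTree → ℕ
size (node ts) = suc (sumSizes ts)
  where
  sumSizes : List RTree → ℕ
  sumSizes [] = 0
  sumSizes (t ∷ ts) = size t + sumSizes ts

data Pos : RTree → Set where
  root : ∀ {ts} → Pos (node ts)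
  down : ∀ {ts t} → t ∈ ts → Pos t → Pos (node ts)

-- edges of the tree: Parent p q  means q is a child of p
data Parent : ∀ {t} → Pos t → Pos t → Set where
  parent-root : ∀ {ts us} (m : node us ∈ ts) → Parent {node ts} root (down m root)
  parent-down : ∀ {ts t} (m : t ∈ ts) {p q : Pos t} →
                Parent p q → Parent {node ts} (down m p) (down m q)

-- The perfect ternary tree with C+1 levels (leaves indexed by Vec (Fin 3) C),
-- with the rooted tree S v glued at leaf v: the leaf is identified with the
-- root of S v (the root of S v being the chosen vertex of the glued tree).
glue : (C : ℕ) → (Vec (Fin 3) C → RTree) → RTree
glue zero S = S []
glue (suc C) S =
  node ( glue C (λ v → S (zero ∷ v))
       ∷ glue C (λ v → S (suc zero ∷ v))
       ∷ glue C (λ v → S (suc (suc zero) ∷ v))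
       ∷ [])

data Vert (n C : ℕ) : Set where
  u1 : Fin n → Vert n C
  u2 : Fin n → Vert n C
  w  : Fin C → Vert n C

data Adj {n C : ℕ} : Vert n C → Vert n C → Set where
  u1u1 : ∀ {a b} → ¬ a ≡ b → Adj (u1 a) (u1 b)
  u2u2 : ∀ {a b} → ¬ a ≡ b → Adj (u2 a) (u2 b)
  u1w  : ∀ {a c} → Adj (u1 a) (w c)
  wu1  : ∀ {a c} → Adj (w c) (u1 a)
  u2w  : ∀ {a c} → Adj (u2 a) (w c)
  wu2  : ∀ {a c} → Adj (w c) (u2 a)

Copy : RTree → ℕ → ℕ → Set
Copy T n C =
  Σ (Pos T → Vert n C) λ f →
    (∀ p q → f p ≡ f q → p ≡ q) ×
    (∀ p q → Parent p q → Adj (f p) (f q))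

-- Label each vertex of the ternary skeleton T′ of a copy of T by the part of G it lands in,
-- a leaf being labelled X as soon as its glued tree meets W.  As U₁ and U₂ are not adjacent,
-- no A is next to a B; an X-free glued tree is connected and avoids W, so it lies inside one
-- part and puts r vertices there; and at most |W| = C labels are X.  It remains to show that
-- a ternary tree of height h with at most h X labels and no A–B edge has
-- |#A-leaves − #B-leaves| ≥ 1 + #X-leaves, so that #A or #B is at least (3^h + 1)/2.
-- Cut at depth e = h − k.  If no depth-e subtree contains an X, each is uniformly A or B and
-- the balance #A − #B is a sum of an odd number of terms ±3^k, so |balance| ≥ 3^k.  Otherwise
-- replace the d ≥ 1 subtrees containing an X by uniform ones: this removes at least d X labels
-- and moves the balance by at most 2d·3^k − #X-leaves, so induction with k + d in place of k
-- gives |balance| ≥ 3^(k+d) − 2d·3^k + #X-leaves ≥ 3^k + #X-leaves.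

module Submission where

open import Defs
open import Data.Nat as ℕ using (ℕ; zero; suc; _+_; _*_; _^_; _≤_; _<_; _∸_; _⊓_; z≤n; s≤s)
import Data.Nat.Properties as ℕ
open import Data.Nat.Induction using (<-wellFounded)
import Data.Nat.Tactic.RingSolver as ℕ-Solver
open import Data.Integer as ℤ using (ℤ; +_; -[1+_]; ∣_∣; _⊖_)
  renaming (_+_ to _+ℤ_; _-_ to _-ℤ_; _*_ to _*ℤ_; -_ to -ℤ_)
import Data.Integer.Properties as ℤ
import Data.Integer.Tactic.RingSolver as ℤ-Solver
open import Data.Fin using (Fin; zero; suc)
open import Data.Fin.Properties using (injective⇒≤)
open import Data.Vec using (Vec; []; _∷_)
open import Data.List using (List; []; _∷_; _++_; map; length; lookup)
import Data.List.Properties as List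
open import Data.List.Membership.Propositional using (_∈_)
open import Data.List.Membership.Propositional.Properties using (∈-lookup)
open import Data.List.Relation.Unary.Any using (here; there)
open import Data.List.Relation.Unary.All as All using (All; []; _∷_)
import Data.List.Relation.Unary.All.Properties as All
open import Data.List.Relation.Unary.Unique.Propositional using (Unique; []; _∷_)
import Data.List.Relation.Unary.Unique.Propositional.Properties as Unique
open import Data.List.Relation.Binary.Disjoint.Propositional using (Disjoint)
open import Data.Empty using (⊥)
open import Data.Unit using (⊤; tt)
open import Data.Product using (∃; _×_; _,_)
open import Data.Sum using (_⊎_; inj₁; inj₂; [_,_])
open import Function using (_∘_)
open import Induction.WellFounded using (Acc; acc)
open import Relation.Binary.PropositionalEquality using (_≡_; refl; sym; trans; cong; cong₂; subst; module ≡-Reasoning)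
open import Relation.Nullary using (¬_; Dec; yes; no; contradiction)
open import Relation.Unary using (Decidable)

-- Labelled ternary trees

-- A, B, X: the vertex is mapped into U₁, U₂, W respectively.
data Label : Set where
  A B X : Label

_≟_ : (l l′ : Label) → Dec (l ≡ l′)
A ≟ A = yes refl
A ≟ B = no λ ()
A ≟ X = no λ ()
B ≟ A = no λ ()
B ≟ B = yes refl
B ≟ X = no λ ()
X ≟ A = no λ ()
X ≟ B = no λ ()
X ≟ X = yes refl

[_≐_] : Label → Label → ℕ
[ l ≐ l′ ] with l ≟ l′
... | yes _ = 1
... | no _  = 0

≐-refl : ∀ l → [ l ≐ l ] ≡ 1
≐-refl l with l ≟ l
... | yes _ = refl
... | no l≢l = contradiction refl l≢l

≐-≢ : ∀ {l l′} → ¬ l ≡ l′ → [ l ≐ l′ ] ≡ 0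
≐-≢ {l} {l′} l≢l′ with l ≟ l′
... | yes l≡l′ = contradiction l≡l′ l≢l′
... | no _ = refl

data _⌣_ : Label → Label → Set where
  X⌣ : ∀ {l} → X ⌣ l
  ⌣X : ∀ {l} → l ⌣ X
  ⌣-refl : ∀ {l} → l ⌣ l

⌣-nonX⇒≡ : ∀ {l l′} → l ⌣ l′ → ¬ l ≡ X → ¬ l′ ≡ X → l ≡ l′
⌣-nonX⇒≡ X⌣ l≢X _ = contradiction refl l≢X
⌣-nonX⇒≡ ⌣X _ l′≢X = contradiction refl l′≢X
⌣-nonX⇒≡ ⌣-refl _ _ = refl

data LTree : ℕ → Set where
  leaf : Label → LTree 0
  branch : ∀ {h} → Label → (a b c : LTree h) → LTree (suc h)

label : ∀ {h} → LTree h → Label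
label (leaf l) = l
label (branch l _ _ _) = l

data Valid : ∀ {h} → LTree h → Set where
  leaf : ∀ {l} → Valid (leaf l)
  branch : ∀ {h l} {a b c : LTree h} → l ⌣ label a → l ⌣ label b → l ⌣ label c →
           Valid a → Valid b → Valid c → Valid (branch l a b c)

#X : ∀ {h} → LTree h → ℕ
#X (leaf l) = [ X ≐ l ]
#X (branch l a b c) = [ X ≐ l ] + (#X a + #X b + #X c)

leaves : Label → ∀ {h} → LTree h → ℕ
leaves l (leaf l′) = [ l ≐ l′ ]
leaves l (branch _ a b c) = leaves l a + leaves l b + leaves l c

value : Label → ℤ
value A = + 1
value B = -[1+ 0 ]
value X = + 0

balance : ∀ {h} → LTree h → ℤ
balance (leaf l) = value l
balance (branch _ a b c) = balance a +ℤ balance b +ℤ balance c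

sum₃≡0 : ∀ {a b c} → a + b + c ≡ 0 → a ≡ 0 × b ≡ 0 × c ≡ 0
sum₃≡0 {a} {b} eq = ℕ.m+n≡0⇒m≡0 a a+b≡0 , ℕ.m+n≡0⇒n≡0 a a+b≡0 , ℕ.m+n≡0⇒n≡0 (a + b) eq
  where
  a+b≡0 = ℕ.m+n≡0⇒m≡0 (a + b) eq

+-mono₃-≤ : ∀ {I : Set} (f g : I → ℕ) (x y z : I) {u v w} →
            f x + g x ≤ u → f y + g y ≤ v → f z + g z ≤ w →
            (f x + f y + f z) + (g x + g y + g z) ≤ u + v + w
+-mono₃-≤ f g x y z le₁ le₂ le₃ =
  ℕ.≤-trans (ℕ.≤-reflexive (interchange (f x) (f y) (f z) (g x) (g y) (g z)))
            (ℕ.+-mono-≤ (ℕ.+-mono-≤ le₁ le₂) le₃)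
  where
  interchange : ∀ a₁ a₂ a₃ c₁ c₂ c₃ →
                (a₁ + a₂ + a₃) + (c₁ + c₂ + c₃) ≡ (a₁ + c₁) + (a₂ + c₂) + (a₃ + c₃)
  interchange = ℕ-Solver.solve-∀

∣x+y+z∣≤ : ∀ x y z → ∣ x +ℤ y +ℤ z ∣ ≤ ∣ x ∣ + ∣ y ∣ + ∣ z ∣
∣x+y+z∣≤ x y z =
  ℕ.≤-trans (ℤ.∣i+j∣≤∣i∣+∣j∣ (x +ℤ y) z) (ℕ.+-monoˡ-≤ ∣ z ∣ (ℤ.∣i+j∣≤∣i∣+∣j∣ x y))

3^suc : ∀ h → 3 ^ suc h ≡ 3 ^ h + 3 ^ h + 3 ^ h
3^suc h = solve (3 ^ h)
  where
  solve : ∀ q → 3 * q ≡ q + q + q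
  solve = ℕ-Solver.solve-∀

#X≡0⇒label≢X : ∀ {h} (t : LTree h) → #X t ≡ 0 → ¬ label t ≡ X
#X≡0⇒label≢X (leaf .X) eq refl = contradiction (trans (sym (≐-refl X)) eq) λ ()
#X≡0⇒label≢X (branch .X a b c) eq refl =
  contradiction (trans (cong (_+ (#X a + #X b + #X c)) (sym (≐-refl X))) eq) λ ()

leaves-X≤#X : ∀ {h} (t : LTree h) → leaves X t ≤ #X t
leaves-X≤#X (leaf l) = ℕ.≤-refl
leaves-X≤#X (branch l a b c) =
  ℕ.≤-trans (ℕ.+-mono-≤ (ℕ.+-mono-≤ (leaves-X≤#X a) (leaves-X≤#X b)) (leaves-X≤#X c))
            (ℕ.m≤n+m _ [ X ≐ l ])

∣balance∣+leaves-X≤3^h : ∀ {h} (t : LTree h) → ∣ balance t ∣ + leaves X t ≤ 3 ^ h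
∣balance∣+leaves-X≤3^h (leaf A) = ℕ.≤-refl
∣balance∣+leaves-X≤3^h (leaf B) = ℕ.≤-refl
∣balance∣+leaves-X≤3^h (leaf X) = ℕ.≤-refl
∣balance∣+leaves-X≤3^h {suc h} (branch _ a b c) = begin
  ∣ balance a +ℤ balance b +ℤ balance c ∣ + (leaves X a + leaves X b + leaves X c)
    ≤⟨ ℕ.+-monoˡ-≤ _ (∣x+y+z∣≤ (balance a) (balance b) (balance c)) ⟩
  (∣ balance a ∣ + ∣ balance b ∣ + ∣ balance c ∣) + (leaves X a + leaves X b + leaves X c)
    ≤⟨ +-mono₃-≤ (∣_∣ ∘ balance) (leaves X) a b c
                 (∣balance∣+leaves-X≤3^h a) (∣balance∣+leaves-X≤3^h b) (∣balance∣+leaves-X≤3^h c) ⟩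
  3 ^ h + 3 ^ h + 3 ^ h
    ≡⟨ 3^suc h ⟨
  3 ^ suc h ∎
  where open ℕ.≤-Reasoning

uniform : ∀ h → Label → LTree h
uniform zero l = leaf l
uniform (suc h) l = branch l (uniform h l) (uniform h l) (uniform h l)

label-uniform : ∀ h l → label (uniform h l) ≡ l
label-uniform zero l = refl
label-uniform (suc h) l = refl

uniform-valid : ∀ h l → Valid (uniform h l)
uniform-valid zero l = leaf
uniform-valid (suc h) l = branch ⌣l ⌣l ⌣l (uniform-valid h l) (uniform-valid h l) (uniform-valid h l)
  where
  ⌣l : l ⌣ label (uniform h l)
  ⌣l = subst (l ⌣_) (sym (label-uniform h l)) ⌣-refl

#X-uniform : ∀ h {l} → ¬ l ≡ X → #X (uniform h l) ≡ 0
#X-uniform zero l≢X = ≐-≢ (λ X≡l → l≢X (sym X≡l))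
#X-uniform (suc h) l≢X
  rewrite ≐-≢ {X} (λ X≡l → l≢X (sym X≡l)) | #X-uniform h l≢X = refl

balance-X-free : ∀ {h} (t : LTree h) → Valid t → #X t ≡ 0 → balance t ≡ value (label t) *ℤ + 3 ^ h
balance-X-free (leaf l) _ _ = sym (ℤ.*-identityʳ (value l))
balance-X-free {suc h} (branch l a b c) (branch l⌣a l⌣b l⌣c va vb vc) eq
  with (eqa , eqb , eqc) ← sum₃≡0 {#X a} {#X b} {#X c} (ℕ.m+n≡0⇒n≡0 [ X ≐ l ] eq) = begin
    balance a +ℤ balance b +ℤ balance c
      ≡⟨ cong₂ _+ℤ_ (cong₂ _+ℤ_ (child a l⌣a va eqa) (child b l⌣b vb eqb)) (child c l⌣c vc eqc) ⟩
    v *ℤ q +ℤ v *ℤ q +ℤ v *ℤ q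
      ≡⟨ distrib v q ⟩
    v *ℤ (q +ℤ q +ℤ q)
      ≡⟨ cong (v *ℤ_) (trans (ℤ.pos-+ (3 ^ h + 3 ^ h) (3 ^ h)) (cong (_+ℤ q) (ℤ.pos-+ (3 ^ h) (3 ^ h)))) ⟨
    v *ℤ + (3 ^ h + 3 ^ h + 3 ^ h)
      ≡⟨ cong (λ n → v *ℤ + n) (3^suc h) ⟨
    v *ℤ + 3 ^ suc h ∎
  where
  open ≡-Reasoning
  v = value l
  q = + 3 ^ h
  l≢X : ¬ l ≡ X
  l≢X = #X≡0⇒label≢X (branch l a b c) eq
  child : (t : LTree h) → l ⌣ label t → Valid t → #X t ≡ 0 → balance t ≡ v *ℤ q
  child t l⌣t vt eqt =
    trans (balance-X-free t vt eqt)
          (cong (λ l′ → value l′ *ℤ q) (sym (⌣-nonX⇒≡ l⌣t l≢X (#X≡0⇒label≢X t eqt))))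
  distrib : ∀ v q → v *ℤ q +ℤ v *ℤ q +ℤ v *ℤ q ≡ v *ℤ (q +ℤ q +ℤ q)
  distrib = ℤ-Solver.solve-∀

OddMultiple : ℕ → ℤ → Set
OddMultiple q z = ∃ λ m → z ≡ + q *ℤ (+ 1 +ℤ + 2 *ℤ m)

oddMultiple-value : ∀ q {l} → ¬ l ≡ X → OddMultiple q (value l *ℤ + q)
oddMultiple-value q {A} _ = + 0 , solve (+ q)
  where
  solve : ∀ x → + 1 *ℤ x ≡ x *ℤ (+ 1 +ℤ + 2 *ℤ + 0)
  solve = ℤ-Solver.solve-∀
oddMultiple-value q {B} _ = -[1+ 0 ] , solve (+ q)
  where
  solve : ∀ x → -[1+ 0 ] *ℤ x ≡ x *ℤ (+ 1 +ℤ + 2 *ℤ -[1+ 0 ])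
  solve = ℤ-Solver.solve-∀
oddMultiple-value q {X} X≢X = contradiction refl X≢X

oddMultiple-+₃ : ∀ q {x y z} → OddMultiple q x → OddMultiple q y → OddMultiple q z → OddMultiple q (x +ℤ y +ℤ z)
oddMultiple-+₃ q (a , refl) (b , refl) (c , refl) = a +ℤ b +ℤ c +ℤ + 1 , solve (+ q) a b c
  where
  solve : ∀ q a b c → q *ℤ (+ 1 +ℤ + 2 *ℤ a) +ℤ q *ℤ (+ 1 +ℤ + 2 *ℤ b) +ℤ q *ℤ (+ 1 +ℤ + 2 *ℤ c)
                      ≡ q *ℤ (+ 1 +ℤ + 2 *ℤ (a +ℤ b +ℤ c +ℤ + 1))
  solve = ℤ-Solver.solve-∀

oddMultiple⇒≤∣∣ : ∀ {q z} → OddMultiple q z → q ≤ ∣ z ∣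
oddMultiple⇒≤∣∣ {q} (m , refl) rewrite ℤ.abs-* (+ q) (+ 1 +ℤ + 2 *ℤ m) =
  ℕ.m≤m*n q _ {{∣odd∣≢0 m}}
  where
  negate : ∀ x → + 1 +ℤ + 2 *ℤ (-ℤ (+ 1 +ℤ x)) ≡ -ℤ (+ 1 +ℤ + 2 *ℤ x)
  negate = ℤ-Solver.solve-∀
  ∣odd∣≢0 : ∀ m → ℕ.NonZero ∣ + 1 +ℤ + 2 *ℤ m ∣
  ∣odd∣≢0 (+ n) rewrite sym (ℤ.pos-* 2 n) = _
  ∣odd∣≢0 -[1+ n ] rewrite negate (+ n) | ℤ.∣-i∣≡∣i∣ (+ 1 +ℤ + 2 *ℤ + n) | sym (ℤ.pos-* 2 n) = _

-- Pruning at a fixed depth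

-- Any non-X label compatible with l would do as the label of subtrees replaced below l.
inherit : Label → Label
inherit X = A
inherit l = l

inherit≢X : ∀ l → ¬ inherit l ≡ X
inherit≢X A ()
inherit≢X B ()
inherit≢X X ()

⌣inherit : ∀ l → l ⌣ inherit l
⌣inherit A = ⌣-refl
⌣inherit B = ⌣-refl
⌣inherit X = X⌣

replaceIf : ∀ {h} → ℕ → Label → LTree h → LTree h
replaceIf zero _ t = t
replaceIf {h} (suc _) l _ = uniform h l

prune : ∀ e {k} → Label → LTree (e + k) → LTree (e + k)
prune zero l t = replaceIf (#X t) l t
prune (suc e) _ (branch l a b c) = branch l (prune e (inherit l) a) (prune e (inherit l) b) (prune e (inherit l) c)

#X-subtrees : ∀ e {k} → LTree (e + k) → ℕ
#X-subtrees zero t = 1 ⊓ #X t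
#X-subtrees (suc e) (branch _ a b c) = #X-subtrees e a + #X-subtrees e b + #X-subtrees e c

label-replaceIf : ∀ {h} n l (t : LTree h) → label (replaceIf n l t) ≡ label t ⊎ label (replaceIf n l t) ≡ l
label-replaceIf zero l t = inj₁ refl
label-replaceIf {h} (suc _) l t = inj₂ (label-uniform h l)

label-prune : ∀ e {k} l (t : LTree (e + k)) → label (prune e l t) ≡ label t ⊎ label (prune e l t) ≡ l
label-prune zero l t = label-replaceIf (#X t) l t
label-prune (suc e) _ (branch _ _ _ _) = inj₁ refl

prune-valid : ∀ e {k} l (t : LTree (e + k)) → Valid t → Valid (prune e l t)
prune-valid zero l t v with #X t
... | zero = v
... | suc _ = uniform-valid _ l
prune-valid (suc e) _ (branch l a b c) (branch l⌣a l⌣b l⌣c va vb vc) =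
  branch (⌣pruned a l⌣a) (⌣pruned b l⌣b) (⌣pruned c l⌣c)
         (prune-valid e (inherit l) a va) (prune-valid e (inherit l) b vb) (prune-valid e (inherit l) c vc)
  where
  ⌣pruned : ∀ t → l ⌣ label t → l ⌣ label (prune e (inherit l) t)
  ⌣pruned t l⌣t with label-prune e (inherit l) t
  ... | inj₁ eq = subst (l ⌣_) (sym eq) l⌣t
  ... | inj₂ eq = subst (l ⌣_) (sym eq) (⌣inherit l)

#X-prune : ∀ e {k} l (t : LTree (e + k)) → ¬ l ≡ X → #X (prune e l t) + #X-subtrees e t ≤ #X t
#X-prune zero {k} l t l≢X = #X-replaceIf (#X t) refl
  where
  #X-replaceIf : ∀ n → #X t ≡ n → #X (replaceIf n l t) + 1 ⊓ n ≤ #X t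
  #X-replaceIf zero _ = ℕ.≤-reflexive (ℕ.+-identityʳ (#X t))
  #X-replaceIf (suc _) eq rewrite #X-uniform k l≢X | eq = s≤s z≤n
#X-prune (suc e) _ (branch l a b c) _ =
  ℕ.≤-trans (ℕ.≤-reflexive (ℕ.+-assoc [ X ≐ l ] _ _))
            (ℕ.+-monoʳ-≤ [ X ≐ l ] (+-mono₃-≤ (#X ∘ pruned) (#X-subtrees e) a b c (IH a) (IH b) (IH c)))
  where
  pruned = prune e (inherit l)
  IH : ∀ t → #X (pruned t) + #X-subtrees e t ≤ #X t
  IH t = #X-prune e (inherit l) t (inherit≢X l)

balance-prune : ∀ e {k} l (t : LTree (e + k)) →
                ∣ balance t -ℤ balance (prune e l t) ∣ + leaves X t ≤ #X-subtrees e t * (2 * 3 ^ k)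
balance-prune zero {k} l t = balance-replaceIf (#X t) refl
  where
  balance-replaceIf : ∀ n → #X t ≡ n →
                      ∣ balance t -ℤ balance (replaceIf n l t) ∣ + leaves X t ≤ 1 ⊓ n * (2 * 3 ^ k)
  balance-replaceIf zero eq rewrite ℤ.+-inverseʳ (balance t) = subst (leaves X t ≤_) eq (leaves-X≤#X t)
  balance-replaceIf (suc _) _ = begin
    ∣ balance t -ℤ balance u ∣ + leaves X t
      ≤⟨ ℕ.+-monoˡ-≤ (leaves X t) (ℤ.∣i-j∣≤∣i∣+∣j∣ (balance t) (balance u)) ⟩
    ∣ balance t ∣ + ∣ balance u ∣ + leaves X t
      ≡⟨ swap ∣ balance t ∣ ∣ balance u ∣ (leaves X t) ⟩
    (∣ balance t ∣ + leaves X t) + ∣ balance u ∣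
      ≤⟨ ℕ.+-mono-≤ (∣balance∣+leaves-X≤3^h t) (ℕ.m+n≤o⇒m≤o _ (∣balance∣+leaves-X≤3^h u)) ⟩
    3 ^ k + 3 ^ k
      ≡⟨ double (3 ^ k) ⟨
    1 * (2 * 3 ^ k) ∎
    where
    open ℕ.≤-Reasoning
    u = uniform k l
    swap : ∀ x y z → x + y + z ≡ (x + z) + y
    swap = ℕ-Solver.solve-∀
    double : ∀ x → 1 * (2 * x) ≡ x + x
    double = ℕ-Solver.solve-∀
balance-prune (suc e) {k} _ (branch l a b c) = begin
  ∣ (balance a +ℤ balance b +ℤ balance c) -ℤ
    (balance (pruned a) +ℤ balance (pruned b) +ℤ balance (pruned c)) ∣ + (leaves X a + leaves X b + leaves X c)
    ≡⟨ cong (λ z → ∣ z ∣ + (leaves X a + leaves X b + leaves X c))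
            (regroup (balance a) (balance b) (balance c)
                     (balance (pruned a)) (balance (pruned b)) (balance (pruned c))) ⟩
  ∣ Δ a +ℤ Δ b +ℤ Δ c ∣ + (leaves X a + leaves X b + leaves X c)
    ≤⟨ ℕ.+-monoˡ-≤ _ (∣x+y+z∣≤ (Δ a) (Δ b) (Δ c)) ⟩
  (∣ Δ a ∣ + ∣ Δ b ∣ + ∣ Δ c ∣) + (leaves X a + leaves X b + leaves X c)
    ≤⟨ +-mono₃-≤ (∣_∣ ∘ Δ) (leaves X) a b c (IH a) (IH b) (IH c) ⟩
  #X-subtrees e a * q + #X-subtrees e b * q + #X-subtrees e c * q
    ≡⟨ distrib (#X-subtrees e a) (#X-subtrees e b) (#X-subtrees e c) q ⟩
  (#X-subtrees e a + #X-subtrees e b + #X-subtrees e c) * q ∎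
  where
  open ℕ.≤-Reasoning
  q = 2 * 3 ^ k
  pruned = prune e (inherit l)
  Δ : LTree (e + k) → ℤ
  Δ t = balance t -ℤ balance (pruned t)
  IH : ∀ t → ∣ Δ t ∣ + leaves X t ≤ #X-subtrees e t * q
  IH = balance-prune e (inherit l)
  regroup : ∀ x y z x′ y′ z′ →
            (x +ℤ y +ℤ z) -ℤ (x′ +ℤ y′ +ℤ z′) ≡ (x -ℤ x′) +ℤ (y -ℤ y′) +ℤ (z -ℤ z′)
  regroup = ℤ-Solver.solve-∀
  distrib : ∀ x y z q → x * q + y * q + z * q ≡ (x + y + z) * q
  distrib = ℕ-Solver.solve-∀

#X-subtrees≡0⇒oddMultiple : ∀ e {k} (t : LTree (e + k)) → Valid t → #X-subtrees e t ≡ 0 →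
                            leaves X t ≡ 0 × OddMultiple (3 ^ k) (balance t)
#X-subtrees≡0⇒oddMultiple zero {k} t v eq =
  ℕ.n≤0⇒n≡0 (subst (leaves X t ≤_) X-free (leaves-X≤#X t)) ,
  subst (OddMultiple (3 ^ k)) (sym (balance-X-free t v X-free))
        (oddMultiple-value (3 ^ k) (#X≡0⇒label≢X t X-free))
  where
  1⊓n≡0⇒n≡0 : ∀ n → 1 ⊓ n ≡ 0 → n ≡ 0
  1⊓n≡0⇒n≡0 zero _ = refl
  X-free : #X t ≡ 0
  X-free = 1⊓n≡0⇒n≡0 (#X t) eq
#X-subtrees≡0⇒oddMultiple (suc e) {k} (branch l a b c) (branch _ _ _ va vb vc) eq
  with (eqa , eqb , eqc) ← sum₃≡0 {#X-subtrees e a} {#X-subtrees e b} {#X-subtrees e c} eq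
  with (Xa , oa) ← #X-subtrees≡0⇒oddMultiple e a va eqa
  with (Xb , ob) ← #X-subtrees≡0⇒oddMultiple e b vb eqb
  with (Xc , oc) ← #X-subtrees≡0⇒oddMultiple e c vc eqc =
  cong₂ _+_ (cong₂ _+_ Xa Xb) Xc , oddMultiple-+₃ (3 ^ k) oa ob oc

1+2n≤3^n : ∀ n → 1 + 2 * n ≤ 3 ^ n
1+2n≤3^n zero = ℕ.≤-refl
1+2n≤3^n (suc n) = begin
  1 + 2 * suc n           ≡⟨ solve n ⟩
  (1 + 2 * n) + 1 + 1     ≤⟨ ℕ.+-mono-≤ (ℕ.+-mono-≤ (1+2n≤3^n n) 1≤3^n) 1≤3^n ⟩
  3 ^ n + 3 ^ n + 3 ^ n   ≡⟨ 3^suc n ⟨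
  3 ^ suc n ∎
  where
  open ℕ.≤-Reasoning
  solve : ∀ n → 1 + 2 * suc n ≡ (1 + 2 * n) + 1 + 1
  solve = ℕ-Solver.solve-∀
  1≤3^n : 1 ≤ 3 ^ n
  1≤3^n = ℕ.m+n≤o⇒m≤o 1 (1+2n≤3^n n)

∣y∣≤∣x∣+∣x-y∣ : ∀ x y → ∣ y ∣ ≤ ∣ x ∣ + ∣ x -ℤ y ∣
∣y∣≤∣x∣+∣x-y∣ x y =
  subst (λ z → ∣ z ∣ ≤ ∣ x ∣ + ∣ x -ℤ y ∣) (solve x y) (ℤ.∣i-j∣≤∣i∣+∣j∣ x (x -ℤ y))
  where
  solve : ∀ x y → x -ℤ (x -ℤ y) ≡ y
  solve = ℤ-Solver.solve-∀

balance-bound : ∀ e k {h} → h ≡ e + k → (t : LTree h) → Acc _<_ (#X t) → Valid t → #X t ≤ e →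
                3 ^ k + leaves X t ≤ ∣ balance t ∣
balance-bound e k refl t (acc rec) v X≤e with #X-subtrees e t in dirty
... | zero with (X-free , odd) ← #X-subtrees≡0⇒oddMultiple e t v dirty =
  subst (λ n → 3 ^ k + n ≤ ∣ balance t ∣) (sym X-free)
        (subst (_≤ ∣ balance t ∣) (sym (ℕ.+-identityʳ (3 ^ k))) (oddMultiple⇒≤∣∣ odd))
... | suc c = ℕ.+-cancelʳ-≤ (d * (2 * 3 ^ k)) _ _ (begin
  3 ^ k + leaves X t + d * (2 * 3 ^ k)  ≡⟨ solve (3 ^ k) (leaves X t) d ⟩
  (1 + 2 * d) * 3 ^ k + leaves X t      ≤⟨ ℕ.+-monoˡ-≤ (leaves X t) grow ⟩
  3 ^ (k + d) + leaves X t              ≤⟨ ℕ.+-monoˡ-≤ (leaves X t) (ℕ.m+n≤o⇒m≤o _ IH) ⟩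
  ∣ balance t′ ∣ + leaves X t            ≤⟨ ℕ.+-monoˡ-≤ (leaves X t) (∣y∣≤∣x∣+∣x-y∣ (balance t) (balance t′)) ⟩
  ∣ balance t ∣ + ∣ balance t -ℤ balance t′ ∣ + leaves X t
                                         ≡⟨ ℕ.+-assoc ∣ balance t ∣ _ _ ⟩
  ∣ balance t ∣ + (∣ balance t -ℤ balance t′ ∣ + leaves X t)
                                         ≤⟨ ℕ.+-monoʳ-≤ ∣ balance t ∣ diff ⟩
  ∣ balance t ∣ + d * (2 * 3 ^ k) ∎)
  where
  open ℕ.≤-Reasoning
  d = suc c
  t′ = prune e A t
  shrink : #X t′ + d ≤ #X t
  shrink = subst (λ n → #X t′ + n ≤ #X t) dirty (#X-prune e A t λ ())
  X′≤e∸d : #X t′ ≤ e ∸ d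
  X′≤e∸d = ℕ.m+n≤o⇒m≤o∸n (#X t′) (ℕ.≤-trans shrink X≤e)
  depth : e + k ≡ (e ∸ d) + (k + d)
  depth = begin-equality
    e + k             ≡⟨ cong (_+ k) (ℕ.m∸n+n≡m (ℕ.m+n≤o⇒n≤o (#X t′) (ℕ.≤-trans shrink X≤e))) ⟨
    (e ∸ d) + d + k   ≡⟨ ℕ.+-assoc (e ∸ d) d k ⟩
    (e ∸ d) + (d + k) ≡⟨ cong ((e ∸ d) ℕ.+_) (ℕ.+-comm d k) ⟩
    (e ∸ d) + (k + d) ∎
  fewer : #X t′ < #X t
  fewer = ℕ.<-≤-trans (ℕ.m<m+n (#X t′) (s≤s z≤n)) shrink
  IH : 3 ^ (k + d) + leaves X t′ ≤ ∣ balance t′ ∣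
  IH = balance-bound (e ∸ d) (k + d) depth t′ (rec fewer) (prune-valid e A t v) X′≤e∸d
  diff : ∣ balance t -ℤ balance t′ ∣ + leaves X t ≤ d * (2 * 3 ^ k)
  diff = subst (λ n → ∣ balance t -ℤ balance t′ ∣ + leaves X t ≤ n * (2 * 3 ^ k)) dirty (balance-prune e A t)
  grow : (1 + 2 * d) * 3 ^ k ≤ 3 ^ (k + d)
  grow = begin
    (1 + 2 * d) * 3 ^ k ≤⟨ ℕ.*-monoˡ-≤ (3 ^ k) (1+2n≤3^n d) ⟩
    3 ^ d * 3 ^ k       ≡⟨ ℕ.*-comm (3 ^ d) (3 ^ k) ⟩
    3 ^ k * 3 ^ d       ≡⟨ ℕ.^-distribˡ-+-* 3 k d ⟨
    3 ^ (k + d) ∎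
  solve : ∀ p x d → p + x + d * (2 * p) ≡ (1 + 2 * d) * p + x
  solve = ℕ-Solver.solve-∀

balance≡A⊖B : ∀ {h} (t : LTree h) → balance t ≡ leaves A t ⊖ leaves B t
balance≡A⊖B (leaf A) = refl
balance≡A⊖B (leaf B) = refl
balance≡A⊖B (leaf X) = refl
balance≡A⊖B (branch _ a b c) = begin
  balance a +ℤ balance b +ℤ balance c
    ≡⟨ cong₂ _+ℤ_ (cong₂ _+ℤ_ (as-difference a) (as-difference b)) (as-difference c) ⟩
  (+ A₁ -ℤ + B₁) +ℤ (+ A₂ -ℤ + B₂) +ℤ (+ A₃ -ℤ + B₃)
    ≡⟨ regroup (+ A₁) (+ A₂) (+ A₃) (+ B₁) (+ B₂) (+ B₃) ⟩
  (+ A₁ +ℤ + A₂ +ℤ + A₃) -ℤ (+ B₁ +ℤ + B₂ +ℤ + B₃)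
    ≡⟨ cong₂ _-ℤ_ (pos-+₃ A₁ A₂ A₃) (pos-+₃ B₁ B₂ B₃) ⟩
  + (A₁ + A₂ + A₃) -ℤ + (B₁ + B₂ + B₃)
    ≡⟨ ℤ.m-n≡m⊖n (A₁ + A₂ + A₃) (B₁ + B₂ + B₃) ⟩
  (A₁ + A₂ + A₃) ⊖ (B₁ + B₂ + B₃) ∎
  where
  open ≡-Reasoning
  A₁ = leaves A a
  A₂ = leaves A b
  A₃ = leaves A c
  B₁ = leaves B a
  B₂ = leaves B b
  B₃ = leaves B c
  as-difference : ∀ {h} (t : LTree h) → balance t ≡ + leaves A t -ℤ + leaves B t
  as-difference t = trans (balance≡A⊖B t) (sym (ℤ.m-n≡m⊖n (leaves A t) (leaves B t)))
  regroup : ∀ a₁ a₂ a₃ b₁ b₂ b₃ →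
            (a₁ -ℤ b₁) +ℤ (a₂ -ℤ b₂) +ℤ (a₃ -ℤ b₃) ≡ (a₁ +ℤ a₂ +ℤ a₃) -ℤ (b₁ +ℤ b₂ +ℤ b₃)
  regroup = ℤ-Solver.solve-∀
  pos-+₃ : ∀ x y z → + x +ℤ + y +ℤ + z ≡ + (x + y + z)
  pos-+₃ x y z = trans (cong (_+ℤ + z) (sym (ℤ.pos-+ x y))) (sym (ℤ.pos-+ (x + y) z))

leaves-total : ∀ {h} (t : LTree h) → leaves A t + leaves B t + leaves X t ≡ 3 ^ h
leaves-total (leaf A) = refl
leaves-total (leaf B) = refl
leaves-total (leaf X) = refl
leaves-total {suc h} (branch _ a b c) = begin
  (A₁ + A₂ + A₃) + (B₁ + B₂ + B₃) + (X₁ + X₂ + X₃)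
    ≡⟨ regroup A₁ A₂ A₃ B₁ B₂ B₃ X₁ X₂ X₃ ⟩
  (A₁ + B₁ + X₁) + (A₂ + B₂ + X₂) + (A₃ + B₃ + X₃)
    ≡⟨ cong₂ _+_ (cong₂ _+_ (leaves-total a) (leaves-total b)) (leaves-total c) ⟩
  3 ^ h + 3 ^ h + 3 ^ h
    ≡⟨ 3^suc h ⟨
  3 ^ suc h ∎
  where
  open ≡-Reasoning
  A₁ = leaves A a
  A₂ = leaves A b
  A₃ = leaves A c
  B₁ = leaves B a
  B₂ = leaves B b
  B₃ = leaves B c
  X₁ = leaves X a
  X₂ = leaves X b
  X₃ = leaves X c
  regroup : ∀ a₁ a₂ a₃ b₁ b₂ b₃ x₁ x₂ x₃ →
            (a₁ + a₂ + a₃) + (b₁ + b₂ + b₃) + (x₁ + x₂ + x₃) ≡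
            (a₁ + b₁ + x₁) + (a₂ + b₂ + x₂) + (a₃ + b₃ + x₃)
  regroup = ℕ-Solver.solve-∀

gap⇒m+n+d+1≤2n : ∀ {m n} d → m ≤ n → 1 + d ≤ n ∸ m → m + n + d + 1 ≤ 2 * n
gap⇒m+n+d+1≤2n {m} {n} d m≤n gap = begin
  m + n + d + 1       ≡⟨ solve m n d ⟩
  n + (m + (1 + d))   ≤⟨ ℕ.+-monoʳ-≤ n (ℕ.+-monoʳ-≤ m gap) ⟩
  n + (m + (n ∸ m))   ≡⟨ cong (n ℕ.+_) (ℕ.m+[n∸m]≡n m≤n) ⟩
  n + n               ≡⟨ cong (n ℕ.+_) (ℕ.+-identityʳ n) ⟨
  2 * n ∎
  where
  open ℕ.≤-Reasoning
  solve : ∀ m n d → m + n + d + 1 ≡ n + (m + (1 + d))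
  solve = ℕ-Solver.solve-∀

majority-of-gap : ∀ a b d → 1 + d ≤ ∣ a ⊖ b ∣ → a + b + d + 1 ≤ 2 * a ⊎ a + b + d + 1 ≤ 2 * b
majority-of-gap a b d gap with ℕ.≤-total a b
... | inj₁ a≤b = inj₂ (gap⇒m+n+d+1≤2n d a≤b (subst (1 + d ≤_) (ℤ.∣⊖∣-≤ a≤b) gap))
... | inj₂ b≤a = inj₁ (subst (_≤ 2 * a) (cong (λ s → s + d + 1) (ℕ.+-comm b a))
                        (gap⇒m+n+d+1≤2n d b≤a (subst (1 + d ≤_) ∣a⊖b∣≡a∸b gap)))
  where
  ∣a⊖b∣≡a∸b : ∣ a ⊖ b ∣ ≡ a ∸ b
  ∣a⊖b∣≡a∸b = trans (ℤ.∣m⊖n∣≡∣n⊖m∣ a b) (ℤ.∣⊖∣-≤ b≤a)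

majority : ∀ {h} (t : LTree h) → Valid t → #X t ≤ h →
           3 ^ h + 1 ≤ 2 * leaves A t ⊎ 3 ^ h + 1 ≤ 2 * leaves B t
majority {h} t v X≤h =
  subst (λ N → N + 1 ≤ 2 * leaves A t ⊎ N + 1 ≤ 2 * leaves B t) (leaves-total t)
        (majority-of-gap (leaves A t) (leaves B t) (leaves X t) gap)
  where
  gap : 1 + leaves X t ≤ ∣ leaves A t ⊖ leaves B t ∣
  gap = subst (λ z → 1 + leaves X t ≤ ∣ z ∣) (balance≡A⊖B t)
              (balance-bound h 0 (sym (ℕ.+-identityʳ h)) t (<-wellFounded (#X t)) v X≤h)

-- Positions of a rooted tree

unique⇒lookup-injective : ∀ {A : Set} (xs : List A) → Unique xs → ∀ i j → lookup xs i ≡ lookup xs j → i ≡ j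
unique⇒lookup-injective (x ∷ xs) (x∉xs ∷ _) zero zero _ = refl
unique⇒lookup-injective (x ∷ xs) (x∉xs ∷ _) zero (suc j) eq = contradiction eq (All.lookup x∉xs (∈-lookup j))
unique⇒lookup-injective (x ∷ xs) (x∉xs ∷ _) (suc i) zero eq = contradiction (sym eq) (All.lookup x∉xs (∈-lookup i))
unique⇒lookup-injective (x ∷ xs) (_ ∷ u) (suc i) (suc j) eq = cong suc (unique⇒lookup-injective xs u i j eq)

unique⇒length≤ : ∀ {A : Set} {P : A → Set} {m} {xs : List A} → Unique xs → All P xs →
                 (code : ∀ {x} → P x → Fin m) →
                 (∀ {x y} (px : P x) (py : P y) → code px ≡ code py → x ≡ y) →
                 length xs ≤ m
unique⇒length≤ {xs = xs} u all code code-injective =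
  injective⇒≤ {f = encode} λ {i} {j} eq → unique⇒lookup-injective xs u i j (code-injective _ _ eq)
  where
  encode : Fin (length xs) → Fin _
  encode i = code (All.lookup all (∈-lookup i))

disjoint-by : ∀ {A : Set} {P Q : A → Set} {xs ys : List A} →
              All P xs → All Q ys → (∀ {x} → P x → Q x → ⊥) → Disjoint xs ys
disjoint-by ps qs exclusive (x∈xs , x∈ys) = exclusive (All.lookup ps x∈xs) (All.lookup qs x∈ys)

rootOf : (t : RTree) → Pos t
rootOf (node _) = root

shift : ∀ {t ts} → Pos (node ts) → Pos (node (t ∷ ts))
shift root = root
shift (down m p) = down (there m) p

shift-injective : ∀ {t ts} {p q : Pos (node ts)} → shift {t} p ≡ shift q → p ≡ q
shift-injective {p = root} {root} _ = refl
shift-injective {p = down _ _} {down _ _} refl = refl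

down-injective : ∀ {ts t} {m : t ∈ ts} {p q : Pos t} → down m p ≡ down m q → p ≡ q
down-injective refl = refl

downs : ∀ {ts} → (∀ {t} → t ∈ ts → List (Pos t)) → List (Pos (node ts))
downs {[]} _ = []
downs {t ∷ ts} L = map (down (here refl)) (L (here refl)) ++ map shift (downs (λ m → L (there m)))

length-downs : ∀ {t ts} (L : ∀ {u} → u ∈ t ∷ ts → List (Pos u)) →
               length (downs L) ≡ length (L (here refl)) + length (downs (λ m → L (there m)))
length-downs L = trans (List.length-++ (map (down (here refl)) (L (here refl))))
                       (cong₂ _+_ (List.length-map (down (here refl)) (L (here refl)))
                                  (List.length-map shift (downs (λ m → L (there m)))))

All-downs : ∀ {ts} {P : Pos (node ts) → Set} {L : ∀ {t} → t ∈ ts → List (Pos t)} →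
            (∀ {t} (m : t ∈ ts) → All (P ∘ down m) (L m)) → All P (downs L)
All-downs {[]} _ = []
All-downs {t ∷ ts} all =
  All.++⁺ (All.map⁺ (all (here refl))) (All.map⁺ (All-downs (λ m → all (there m))))

downs-unique : ∀ {ts} {L : ∀ {t} → t ∈ ts → List (Pos t)} →
               (∀ {t} (m : t ∈ ts) → Unique (L m)) → Unique (downs L)
downs-unique {[]} _ = []
downs-unique {t ∷ ts} {L} unique =
  Unique.++⁺ (Unique.map⁺ down-injective (unique (here refl)))
             (Unique.map⁺ shift-injective (downs-unique (λ m → unique (there m))))
             (disjoint-by {P = First} {Q = ¬_ ∘ First}
                          (All.map⁺ (All.tabulate λ _ → tt))
                          (All.map⁺ (All.tabulate λ {p} _ → shift-not-first p))
                          λ first not-first → not-first first)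
  where
  First : Pos (node (t ∷ ts)) → Set
  First (down (here _) _) = ⊤
  First _ = ⊥
  shift-not-first : ∀ p → ¬ First (shift p)
  shift-not-first root ()
  shift-not-first (down _ _) ()

mutual
  positions : (t : RTree) → List (Pos t)
  positions (node ts) = root ∷ downs (positionsOf ts)

  positionsOf : ∀ ts {t} → t ∈ ts → List (Pos t)
  positionsOf (t ∷ _) (here refl) = positions t
  positionsOf (_ ∷ ts) (there m) = positionsOf ts m

mutual
  length-positions : ∀ t → length (positions t) ≡ size t
  length-positions (node ts) = cong suc (length-positionsOf ts)

  -- The sum of the children's sizes is local to size, so it is named as pred (size (node ts)).
  length-positionsOf : ∀ ts → length (downs (positionsOf ts)) ≡ ℕ.pred (size (node ts))
  length-positionsOf [] = refl
  length-positionsOf (t ∷ ts) =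
    trans (length-downs (positionsOf (t ∷ ts)))
          (cong₂ _+_ (length-positions t) (length-positionsOf ts))

mutual
  positions-unique : ∀ t → Unique (positions t)
  positions-unique (node ts) =
    All-downs (λ _ → All.tabulate λ _ ()) ∷ downs-unique (positionsOf-unique ts)

  positionsOf-unique : ∀ ts {t} (m : t ∈ ts) → Unique (positionsOf ts m)
  positionsOf-unique (t ∷ _) (here refl) = positions-unique t
  positionsOf-unique (_ ∷ ts) (there m) = positionsOf-unique ts m

mutual
  exists? : ∀ t {P : Pos t → Set} → Decidable P → Dec (∃ P)
  exists? (node ts) P? = existsNode? ts P?

  existsNode? : ∀ ts {P : Pos (node ts) → Set} → Decidable P → Dec (∃ P)
  existsNode? [] P? with P? root
  ... | yes P-root = yes (root , P-root)
  ... | no ¬P-root = no λ { (root , P-root) → ¬P-root P-root }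
  existsNode? (t ∷ ts) P? with exists? t (P? ∘ down (here refl))
  ... | yes (p , Pp) = yes (down (here refl) p , Pp)
  ... | no none-first with existsNode? ts (P? ∘ shift)
  ...   | yes (p , Pp) = yes (shift p , Pp)
  ...   | no none-rest = no λ
    { (root , Pp) → none-rest (root , Pp)
    ; (down (here refl) p , Pp) → none-first (p , Pp)
    ; (down (there m) p , Pp) → none-rest (down m p , Pp)
    }

record AtLeast {t : RTree} (P : Pos t → Set) (k : ℕ) : Set where
  field
    members : List (Pos t)
    distinct : Unique members
    satisfy : All P members
    enough : k ≤ length members

open AtLeast

atLeast-none : ∀ {t} {P : Pos t → Set} → AtLeast P 0
atLeast-none = record { members = [] ; distinct = [] ; satisfy = [] ; enough = z≤n }

atLeast-one : ∀ {t} {P : Pos t → Set} p → P p → AtLeast P 1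
atLeast-one p Pp =
  record { members = p ∷ [] ; distinct = [] ∷ [] ; satisfy = Pp ∷ [] ; enough = ℕ.≤-refl }

atLeast-all : ∀ {t} {P : Pos t → Set} → (∀ p → P p) → AtLeast P (size t)
atLeast-all {t} all = record
  { members = positions t
  ; distinct = positions-unique t
  ; satisfy = All.tabulate λ {p} _ → all p
  ; enough = ℕ.≤-reflexive (sym (length-positions t))
  }

module _ {t₀ t₁ t₂ : RTree} where

  child₀ : Pos t₀ → Pos (node (t₀ ∷ t₁ ∷ t₂ ∷ []))
  child₀ = down (here refl)

  child₁ : Pos t₁ → Pos (node (t₀ ∷ t₁ ∷ t₂ ∷ []))
  child₁ = down (there (here refl))

  child₂ : Pos t₂ → Pos (node (t₀ ∷ t₁ ∷ t₂ ∷ []))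
  child₂ = down (there (there (here refl)))

  module _ {P : Pos (node (t₀ ∷ t₁ ∷ t₂ ∷ [])) → Set} {k₀ k₁ k₂}
           (a₀ : AtLeast (P ∘ child₀) k₀) (a₁ : AtLeast (P ∘ child₁) k₁)
           (a₂ : AtLeast (P ∘ child₂) k₂) where

    private
      L : ∀ {t} → t ∈ t₀ ∷ t₁ ∷ t₂ ∷ [] → List (Pos t)
      L (here refl) = members a₀
      L (there (here refl)) = members a₁
      L (there (there (here refl))) = members a₂

      L-unique : ∀ {t} (m : t ∈ t₀ ∷ t₁ ∷ t₂ ∷ []) → Unique (L m)
      L-unique (here refl) = distinct a₀
      L-unique (there (here refl)) = distinct a₁
      L-unique (there (there (here refl))) = distinct a₂

      L-satisfy : ∀ {t} (m : t ∈ t₀ ∷ t₁ ∷ t₂ ∷ []) → All (P ∘ down m) (L m)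
      L-satisfy (here refl) = satisfy a₀
      L-satisfy (there (here refl)) = satisfy a₁
      L-satisfy (there (there (here refl))) = satisfy a₂

      length-downs-L : length (downs L) ≡
                       length (members a₀) + (length (members a₁) + (length (members a₂) + 0))
      length-downs-L =
        trans (length-downs L)
              (cong (λ n → length (members a₀) + n)
                    (trans (length-downs (λ m → L (there m)))
                           (cong (λ n → length (members a₁) + n) (length-downs (λ m → L (there (there m)))))))

      L-enough : k₀ + k₁ + k₂ ≤ length (downs L)
      L-enough = ℕ.≤-trans (ℕ.+-mono-≤ (ℕ.+-mono-≤ (enough a₀) (enough a₁)) (enough a₂))
                           (ℕ.≤-reflexive (trans (rebracket (length L₀) (length L₁) (length L₂)) (sym length-downs-L)))
        where
        L₀ = members a₀
        L₁ = members a₁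
        L₂ = members a₂
        rebracket : ∀ x y z → x + y + z ≡ x + (y + (z + 0))
        rebracket = ℕ-Solver.solve-∀

    atLeast-branch : AtLeast P (k₀ + k₁ + k₂)
    atLeast-branch = record
      { members = downs L
      ; distinct = downs-unique L-unique
      ; satisfy = All-downs L-satisfy
      ; enough = L-enough
      }

    atLeast-branch-root : P root → AtLeast P (1 + (k₀ + k₁ + k₂))
    atLeast-branch-root P-root = record
      { members = root ∷ downs L
      ; distinct = All-downs {L = L} (λ m → All.tabulate λ _ ()) ∷ downs-unique L-unique
      ; satisfy = P-root ∷ All-downs L-satisfy
      ; enough = s≤s L-enough
      }

-- The host graph and the labelled skeleton of an embedding

module Host {n c : ℕ} where

  part : Vert n c → Label
  part (u1 _) = A
  part (u2 _) = B
  part (w _) = X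

  capacity : Label → ℕ
  capacity X = c
  capacity _ = n

  capacity-nonX : ∀ {l} → ¬ l ≡ X → capacity l ≡ n
  capacity-nonX {A} _ = refl
  capacity-nonX {B} _ = refl
  capacity-nonX {X} X≢X = contradiction refl X≢X

  index : ∀ {l} (x : Vert n c) → part x ≡ l → Fin (capacity l)
  index (u1 a) refl = a
  index (u2 a) refl = a
  index (w c) refl = c

  index-injective : ∀ {l} {x y : Vert n c} (px : part x ≡ l) (py : part y ≡ l) →
                    index x px ≡ index y py → x ≡ y
  index-injective {x = u1 _} {u1 _} refl refl refl = refl
  index-injective {x = u2 _} {u2 _} refl refl refl = refl
  index-injective {x = w _} {w _} refl refl refl = refl

  Adj⇒⌣ : ∀ {x y : Vert n c} → Adj x y → part x ⌣ part y
  Adj⇒⌣ (u1u1 _) = ⌣-refl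
  Adj⇒⌣ (u2u2 _) = ⌣-refl
  Adj⇒⌣ u1w = ⌣X
  Adj⇒⌣ wu1 = X⌣
  Adj⇒⌣ u2w = ⌣X
  Adj⇒⌣ wu2 = X⌣

  atLeast⇒≤capacity : ∀ {t} {g : Pos t → Vert n c} → (∀ p q → g p ≡ g q → p ≡ q) →
                      ∀ l {k} → AtLeast (λ p → part (g p) ≡ l) k → k ≤ capacity l
  atLeast⇒≤capacity {g = g} g-injective l a = begin
    _                       ≤⟨ enough a ⟩
    length (members a)      ≡⟨ List.length-map g (members a) ⟨
    length (map g (members a))
      ≤⟨ unique⇒length≤ (Unique.map⁺ (g-injective _ _) (distinct a)) (All.map⁺ (satisfy a))
                         (index _) index-injective ⟩
    capacity l ∎
    where open ℕ.≤-Reasoning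

  Hom : ∀ {t} → (Pos t → Vert n c) → Set
  Hom g = ∀ p q → Parent p q → Adj (g p) (g q)

  Hom-down : ∀ {ts t} (m : t ∈ ts) {g : Pos (node ts) → Vert n c} → Hom g → Hom (g ∘ down m)
  Hom-down m hom p q p→q = hom _ _ (parent-down m p→q)

  Adj-root-child : ∀ {ts t} (m : t ∈ ts) {g : Pos (node ts) → Vert n c} → Hom g →
                   Adj (g root) (g (down m (rootOf t)))
  Adj-root-child {t = node _} m hom = hom _ _ (parent-root m)

  part-constant : ∀ t {g : Pos t → Vert n c} → Hom g → (∀ p → ¬ part (g p) ≡ X) →
                  ∀ p → part (g p) ≡ part (g (rootOf t))
  part-constant (node ts) hom no-X root = refl
  part-constant (node ts) hom no-X (down {t = t} m p) =
    trans (part-constant t (Hom-down m hom) (no-X ∘ down m) p)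
          (sym (⌣-nonX⇒≡ (Adj⇒⌣ (Adj-root-child m hom)) (no-X root) (no-X (down m (rootOf t)))))

  leafLabel : (t : RTree) → (Pos t → Vert n c) → Label
  leafLabel t g with exists? t (λ p → part (g p) ≟ X)
  ... | yes _ = X
  ... | no _ = part (g (rootOf t))

  leafLabel-cases : ∀ t (g : Pos t → Vert n c) →
                    (leafLabel t g ≡ X × ∃ λ p → part (g p) ≡ X) ⊎
                    (leafLabel t g ≡ part (g (rootOf t)) × ∀ p → ¬ part (g p) ≡ X)
  leafLabel-cases t g with exists? t (λ p → part (g p) ≟ X)
  ... | yes found = inj₁ (refl , found)
  ... | no none = inj₂ (refl , λ p eq → none (p , eq))

  sub : ∀ {C} → Fin 3 → (Vec (Fin 3) (suc C) → RTree) → Vec (Fin 3) C → RTree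
  sub i S v = S (i ∷ v)

  labelTree : ∀ C (S : Vec (Fin 3) C → RTree) → (Pos (glue C S) → Vert n c) → LTree C
  labelTree zero S g = leaf (leafLabel (S []) g)
  labelTree (suc C) S g =
    branch (part (g root)) (labelTree C (sub zero S) (g ∘ child₀))
                           (labelTree C (sub (suc zero) S) (g ∘ child₁))
                           (labelTree C (sub (suc (suc zero)) S) (g ∘ child₂))

  label-labelTree : ∀ C S (g : Pos (glue C S) → Vert n c) →
                    label (labelTree C S g) ≡ X ⊎ label (labelTree C S g) ≡ part (g (rootOf (glue C S)))
  label-labelTree zero S g with leafLabel-cases (S []) g
  ... | inj₁ (eq , _) = inj₁ eq
  ... | inj₂ (eq , _) = inj₂ eq
  label-labelTree (suc C) S g = inj₂ refl

  labelTree-valid : ∀ C S {g : Pos (glue C S) → Vert n c} → Hom g → Valid (labelTree C S g)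
  labelTree-valid zero S hom = leaf
  labelTree-valid (suc C) S {g} hom =
    branch (root⌣ _ (label-labelTree C (sub zero S) (g ∘ child₀)))
           (root⌣ _ (label-labelTree C (sub (suc zero) S) (g ∘ child₁)))
           (root⌣ _ (label-labelTree C (sub (suc (suc zero)) S) (g ∘ child₂)))
           (labelTree-valid C (sub zero S) (Hom-down _ hom))
           (labelTree-valid C (sub (suc zero) S) (Hom-down _ hom))
           (labelTree-valid C (sub (suc (suc zero)) S) (Hom-down _ hom))
    where
    root⌣ : ∀ {t l} (i : t ∈ _) → l ≡ X ⊎ l ≡ part (g (down i (rootOf t))) → part (g root) ⌣ l
    root⌣ i (inj₁ refl) = ⌣X
    root⌣ i (inj₂ refl) = Adj⇒⌣ (Adj-root-child i hom)

  #X-labelTree : ∀ C S (g : Pos (glue C S) → Vert n c) →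
                 AtLeast (λ p → part (g p) ≡ X) (#X (labelTree C S g))
  #X-labelTree zero S g with leafLabel-cases (S []) g
  ... | inj₁ (eq , p , X-at-p) = subst (λ l → AtLeast _ [ X ≐ l ]) (sym eq) (atLeast-one p X-at-p)
  ... | inj₂ (eq , none) =
    subst (AtLeast _) (sym (trans (cong [ X ≐_] eq) (≐-≢ λ X≡root → none (rootOf (S [])) (sym X≡root))))
          atLeast-none
  #X-labelTree (suc C) S g = by-root-vertex (g root) refl
    where
    lt₀ = labelTree C (sub zero S) (g ∘ child₀)
    lt₁ = labelTree C (sub (suc zero) S) (g ∘ child₁)
    lt₂ = labelTree C (sub (suc (suc zero)) S) (g ∘ child₂)
    below₀ = #X-labelTree C (sub zero S) (g ∘ child₀)
    below₁ = #X-labelTree C (sub (suc zero) S) (g ∘ child₁)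
    below₂ = #X-labelTree C (sub (suc (suc zero)) S) (g ∘ child₂)
    by-root-vertex : ∀ x → g root ≡ x →
                     AtLeast (λ p → part (g p) ≡ X) ([ X ≐ part x ] + (#X lt₀ + #X lt₁ + #X lt₂))
    by-root-vertex (u1 _) _ = atLeast-branch below₀ below₁ below₂
    by-root-vertex (u2 _) _ = atLeast-branch below₀ below₁ below₂
    by-root-vertex (w _) eq = atLeast-branch-root below₀ below₁ below₂ (cong part eq)

  leaves-leafLabel : ∀ t {g : Pos t → Vert n c} → Hom g → ∀ {l} → ¬ l ≡ X →
                     AtLeast (λ p → part (g p) ≡ l) ([ l ≐ leafLabel t g ] * size t)
  leaves-leafLabel t {g} hom {l} l≢X with leafLabel-cases t g
  ... | inj₁ (eq , _) rewrite eq | ≐-≢ l≢X = atLeast-none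
  ... | inj₂ (eq , none) rewrite eq with l ≟ part (g (rootOf t))
  ...   | yes refl rewrite ℕ.+-identityʳ (size t) = atLeast-all (part-constant t hom none)
  ...   | no _ = atLeast-none

  leaves-labelTree : ∀ C S {g : Pos (glue C S) → Vert n c} → Hom g → ∀ {r} → (∀ v → size (S v) ≡ r) →
                     ∀ {l} → ¬ l ≡ X →
                     AtLeast (λ p → part (g p) ≡ l) (leaves l (labelTree C S g) * r)
  leaves-labelTree zero S hom sizes {l} l≢X rewrite sym (sizes []) = leaves-leafLabel (S []) hom l≢X
  leaves-labelTree (suc C) S {g} hom {r} sizes {l} l≢X =
    subst (AtLeast (λ p → part (g p) ≡ l)) (distrib (leaves l lt₀) (leaves l lt₁) (leaves l lt₂) r)
      (atLeast-branch
        (leaves-labelTree C (sub zero S) (Hom-down _ hom) (λ v → sizes (zero ∷ v)) l≢X)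
        (leaves-labelTree C (sub (suc zero) S) (Hom-down _ hom) (λ v → sizes (suc zero ∷ v)) l≢X)
        (leaves-labelTree C (sub (suc (suc zero)) S) (Hom-down _ hom) (λ v → sizes (suc (suc zero) ∷ v)) l≢X))
    where
    lt₀ = labelTree C (sub zero S) (g ∘ child₀)
    lt₁ = labelTree C (sub (suc zero) S) (g ∘ child₁)
    lt₂ = labelTree C (sub (suc (suc zero)) S) (g ∘ child₂)
    distrib : ∀ a b c r → a * r + b * r + c * r ≡ (a + b + c) * r
    distrib = ℕ-Solver.solve-∀

-- The bound holds for every r.
lemma5p1 : (C : ℕ) → 1 ≤ C →
    ∃ λ r₀ → (r : ℕ) → r₀ ≤ r →
      (S : Vec (Fin 3) C → RTree) → (∀ v → size (S v) ≡ r) →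
      (n : ℕ) → Copy (glue C S) n C →
      (3 ^ C + 1) * r ≤ 2 * n
lemma5p1 C _ = 0 , λ r _ S sizes n (f , f-injective , f-hom) →
  let open Host
      T = labelTree C S f
      bound : ∀ l → ¬ l ≡ X → 3 ^ C + 1 ≤ 2 * leaves l T → (3 ^ C + 1) * r ≤ 2 * n
      bound l l≢X majority-l = begin
        (3 ^ C + 1) * r      ≤⟨ ℕ.*-monoˡ-≤ r majority-l ⟩
        2 * leaves l T * r   ≡⟨ ℕ.*-assoc 2 (leaves l T) r ⟩
        2 * (leaves l T * r) ≤⟨ ℕ.*-monoʳ-≤ 2 (atLeast⇒≤capacity f-injective l
                                                 (leaves-labelTree C S f-hom sizes l≢X)) ⟩
        2 * capacity l       ≡⟨ cong (2 *_) (capacity-nonX l≢X) ⟩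
        2 * n ∎
  in [ bound A (λ ()) , bound B (λ ()) ]
       (majority T (labelTree-valid C S f-hom) (atLeast⇒≤capacity f-injective X (#X-labelTree C S f)))
  where open ℕ.≤-Reasoning
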